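{- Work in ordinary first-order logic $\mathcal{L}_\omega^\omega$. Let $T_1,T_2,T_3$ be theories with $I(T_1,1)=I(T_2,1)=I(T_3,1)=0$. If $T_1\leadsto T_2\leadsto T_3$, then there is a theory $T$ such that $T_1\leadsto T$ and $T$ is definitionally equivalent to $T_3$.
   Context: $\mathcal{L}_\omega^\omega$: languages are sets of relation symbols of finite rank (no function or constant symbols), with equality and variables $v_i$, $i<\omega$; formulas built from $v_i=v_j$ and atomic formulas by $\land,\lnot,\exists v_i$; models are nonempty sets with relations; standard satisfaction. A theory is a set of formulas of a language; $T\models\varphi$ iff $\varphi$ holds in every model of $T$. $I(T,\kappa)$ is the number of non-isomorphic models of $T$ of cardinality $\kappa$. $T\sqsubseteq T'$ means every formula of $T$'s language is a formula of $T'$'s language and for such $\varphi$, $T'\models\varphi\iff T\models\varphi$. $T\leadsto T'$ iff the language of $T'$ is the language of $T$ together with one relation symbol $R$, and $T\sqsubseteq T'$. A translation $tr$ from formulas of one language to another satisfies $tr(v_i=v_j)=(v_i=v_j)$ and commutes with $\lnot,\land,\exists v_i$; it is an interpretation of $T$ into $T'$ if $T\models\varphi\Rightarrow T'\models tr(\varphi)$. $T$ and $T'$ are definitionally equivalent if there are interpretations $tr$ of $T$ into $T'$ and $tr'$ of $T'$ into $T$ with $T\models tr'(tr(\varphi))\leftrightarrow\varphi$ and $T'\models tr(tr'(\psi))\leftrightarrow\psi$ for all formulas $\varphi$ of $T$'s language and $\psi$ of $T'$'s language. -}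

module Defs where

open import Data.Nat using (ℕ; _≡ᵇ_)
open import Data.Bool using (if_then_else_)
open import Data.Vec using (Vec; map)
open import Data.Sum using (_⊎_; inj₁; inj₂)
open import Data.Unit using (⊤; tt)
open import Data.Empty using (⊥)
open import Data.Product using (Σ; _×_; _,_)
open import Relation.Binary.PropositionalEquality using (_≡_)
open import Relation.Nullary using (¬_; Dec)

record Lang : Set₁ where
  field
    Sym   : Set
    arity : Sym → ℕ
open Lang public

extend : Lang → ℕ → Lang
extend L n = record { Sym = Sym L ⊎ ⊤ ; arity = ar }
  where
  ar : Sym L ⊎ ⊤ → ℕ
  ar (inj₁ R) = arity L R
  ar (inj₂ _) = n

data Formula (L : Lang) : Set where
  eq  : ℕ → ℕ → Formula L
  rel : (R : Sym L) → Vec ℕ (arity L R) → Formula L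
  and : Formula L → Formula L → Formula L
  neg : Formula L → Formula L
  ex  : ℕ → Formula L → Formula L

iff : ∀ {L} → Formula L → Formula L → Formula L
iff φ ψ = and (neg (and φ (neg ψ))) (neg (and ψ (neg φ)))

embed : ∀ {L n} → Formula L → Formula (extend L n)
embed (eq i j) = eq i j
embed (rel R vs) = rel (inj₁ R) vs
embed (and φ ψ) = and (embed φ) (embed ψ)
embed (neg φ) = neg (embed φ)
embed (ex i φ) = ex i (embed φ)

-- Models: nonempty sets with relations.
record Model (L : Lang) : Set₁ where
  field
    Carrier : Set
    point   : Carrier
    relOf   : (R : Sym L) → Vec Carrier (arity L R) → Set
open Model public

_[_≔_] : {A : Set} → (ℕ → A) → ℕ → A → (ℕ → A)
(ρ [ i ≔ a ]) j = if j ≡ᵇ i then a else ρ j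

Sat : ∀ {L} (M : Model L) → (ℕ → Carrier M) → Formula L → Set
Sat M ρ (eq i j) = ρ i ≡ ρ j
Sat M ρ (rel R vs) = relOf M R (map ρ vs)
Sat M ρ (and φ ψ) = Sat M ρ φ × Sat M ρ ψ
Sat M ρ (neg φ) = ¬ Sat M ρ φ
Sat M ρ (ex i φ) = Σ (Carrier M) λ a → Sat M (ρ [ i ≔ a ]) φ

_⊨_ : ∀ {L} → Model L → Formula L → Set
M ⊨ φ = ∀ ρ → Sat M ρ φ

Theory : Lang → Set₁
Theory L = Formula L → Set

IsModel : ∀ {L} → Model L → Theory L → Set
IsModel M T = ∀ φ → T φ → M ⊨ φ

Entails : ∀ {L} → Theory L → Formula L → Set₁
Entails {L} T φ = (M : Model L) → IsModel M T → M ⊨ φ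

HasOneElement : ∀ {L} → Model L → Set
HasOneElement M = Σ (Carrier M) λ a → ∀ b → b ≡ a

NoModelOfSize1 : ∀ {L} → Theory L → Set₁
NoModelOfSize1 {L} T = (M : Model L) → IsModel M T → ¬ HasOneElement M

Leadsto : ∀ {L} n → Theory L → Theory (extend L n) → Set₁
Leadsto {L} n T T' =
  (φ : Formula L) → (Entails T' (embed φ) → Entails T φ) × (Entails T φ → Entails T' (embed φ))

record Translation (L L' : Lang) : Set where
  field
    tr     : Formula L → Formula L'
    tr-eq  : ∀ i j → tr (eq i j) ≡ eq i j
    tr-neg : ∀ φ → tr (neg φ) ≡ neg (tr φ)
    tr-and : ∀ φ ψ → tr (and φ ψ) ≡ and (tr φ) (tr ψ)
    tr-ex  : ∀ i φ → tr (ex i φ) ≡ ex i (tr φ)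
open Translation public

IsInterpretation : ∀ {L L'} → Translation L L' → Theory L → Theory L' → Set₁
IsInterpretation {L} t T T' = (φ : Formula L) → Entails T φ → Entails T' (tr t φ)

DefEquiv : ∀ {L L'} → Theory L → Theory L' → Set₁
DefEquiv {L} {L'} T T' =
  Σ (Translation L L') λ t → Σ (Translation L' L) λ t' →
    IsInterpretation t T T' × IsInterpretation t' T' T ×
    ((φ : Formula L) → Entails T (iff (tr t' (tr t φ)) φ)) ×
    ((ψ : Formula L') → Entails T' (iff (tr t (tr t' ψ)) ψ))

ExcludedMiddle : Set₁
ExcludedMiddle = (P : Set) → Dec P

-- Let P (rank n₂) and Q (rank n₃) be the symbols added by T₁ ⇝ T₂ ⇝ T₃. They can be merged
-- into one symbol R of rank 2 + n₂ + n₃ by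
--   R(x, y, ā, b̄)  :↔  (x = y ∧ P ā) ∨ (x ≠ y ∧ Q b̄),
-- and recovered from it by
--   P ā  ↔  ∃c. R(c, c, ā, c, …, c)      Q b̄  ↔  ∃a ∃b. a ≠ b ∧ R(a, b, a, …, a, b̄).
-- These recover P and Q only in structures with two distinct elements, which models of T₃ have
-- since I(T₃, 1) = 0. The merged theory T consists of T₃ rewritten through them together with the
-- definition of R; the two rewritings are then mutually inverse interpretations fixing the
-- language of T₁, so T₁ ⊑ T₃ gives T₁ ⊑ T.
module Submission where

open import Defs
open import Data.Bool using (true; false)
open import Data.Nat using (ℕ; suc; _+_; _≤_; _⊔_; _≡ᵇ_)
open import Data.Nat.Properties using (≡ᵇ⇒≡; ≡⇒≡ᵇ; m⊔n≤o⇒m≤o; m⊔n≤o⇒n≤o; ≤-refl; n≤1+n; <⇒≢)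
open import Data.Product using (Σ; _×_; _,_; proj₁; proj₂)
open import Data.Product.Function.NonDependent.Propositional using (_×-⇔_)
open import Data.Product.Function.Dependent.Propositional using (Σ-⇔)
open import Data.Sum using (inj₁; inj₂)
open import Data.Unit using (tt)
open import Data.Vec using (Vec; []; _∷_; map; _++_; replicate; take; drop)
open import Data.Vec.Properties using (take-map; drop-map; map-++; map-replicate; take++drop≡id; ++-injective)
open import Function using (_⇔_; mk⇔; Equivalence)
open import Function.Construct.Composition using (_⇔-∘_)
open import Function.Construct.Identity using (↠-id; ⇔-id)
open import Function.Construct.Symmetry using (⇔-sym)
open import Function.Properties.Equivalence using (⇔-isEquivalence)
open import Function.Related.Propositional using (module EquationalReasoning)
open import Function.Related.TypeIsomorphisms using (¬-cong-⇔)
open import Relation.Binary.PropositionalEquality using (_≡_; _≢_; refl; sym; trans; cong; cong₂; subst)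
open import Relation.Binary.Structures using (IsEquivalence)
open import Relation.Nullary using (¬_; yes; no; contradiction)
open import Relation.Nullary.Decidable using (decidable-stable)

open Equivalence using (to; from)

private
  variable
    A : Set
    K K′ K″ : Lang
    k m n : ℕ

≡⇒⇔ : {X Y : Set} → X ≡ Y → X ⇔ Y
≡⇒⇔ = IsEquivalence.reflexive ⇔-isEquivalence

or : Formula K → Formula K → Formula K
or φ ψ = neg (and (neg φ) (neg ψ))

AtomMap : Lang → Lang → Set
AtomMap K K′ = (R : Sym K) → Vec ℕ (arity K R) → Formula K′

replaceAtoms : AtomMap K K′ → Formula K → Formula K′
replaceAtoms σ (eq i j)   = eq i j
replaceAtoms σ (rel R vs) = σ R vs
replaceAtoms σ (and φ ψ)  = and (replaceAtoms σ φ) (replaceAtoms σ ψ)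
replaceAtoms σ (neg φ)    = neg (replaceAtoms σ φ)
replaceAtoms σ (ex i φ)   = ex i (replaceAtoms σ φ)

replaceAtoms-∘ : (τ : AtomMap K′ K″) (σ : AtomMap K K′) (φ : Formula K) →
  replaceAtoms τ (replaceAtoms σ φ) ≡ replaceAtoms (λ R vs → replaceAtoms τ (σ R vs)) φ
replaceAtoms-∘ τ σ (eq i j)   = refl
replaceAtoms-∘ τ σ (rel R vs) = refl
replaceAtoms-∘ τ σ (and φ ψ)  = cong₂ and (replaceAtoms-∘ τ σ φ) (replaceAtoms-∘ τ σ ψ)
replaceAtoms-∘ τ σ (neg φ)    = cong neg (replaceAtoms-∘ τ σ φ)
replaceAtoms-∘ τ σ (ex i φ)   = cong (ex i) (replaceAtoms-∘ τ σ φ)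

atomTranslation : AtomMap K K′ → Translation K K′
atomTranslation σ = record
  { tr     = replaceAtoms σ
  ; tr-eq  = λ _ _ → refl
  ; tr-neg = λ _ → refl
  ; tr-and = λ _ _ → refl
  ; tr-ex  = λ _ _ → refl
  }

withRelations : (M : Model K′) → ((R : Sym K) → Vec (Carrier M) (arity K R) → Set) → Model K
withRelations M r = record { Carrier = Carrier M ; point = point M ; relOf = r }

Sat-replaceAtoms : (M : Model K′) (r : (R : Sym K) → Vec (Carrier M) (arity K R) → Set) (σ : AtomMap K K′) →
  (∀ ρ R vs → r R (map ρ vs) ⇔ Sat M ρ (σ R vs)) →
  ∀ ρ φ → Sat (withRelations M r) ρ φ ⇔ Sat M ρ (replaceAtoms σ φ)
Sat-replaceAtoms M r σ atoms ρ (eq i j)   = ⇔-id _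
Sat-replaceAtoms M r σ atoms ρ (rel R vs) = atoms ρ R vs
Sat-replaceAtoms M r σ atoms ρ (and φ ψ)  =
  Sat-replaceAtoms M r σ atoms ρ φ ×-⇔ Sat-replaceAtoms M r σ atoms ρ ψ
Sat-replaceAtoms M r σ atoms ρ (neg φ)    = ¬-cong-⇔ (Sat-replaceAtoms M r σ atoms ρ φ)
Sat-replaceAtoms M r σ atoms ρ (ex i φ)   =
  Σ-⇔ (↠-id _) (λ {a} → Sat-replaceAtoms M r σ atoms (ρ [ i ≔ a ]) φ)

Sat-iff : ExcludedMiddle → (M : Model K) (ρ : ℕ → Carrier M) (φ ψ : Formula K) →
  Sat M ρ (iff φ ψ) ⇔ (Sat M ρ φ ⇔ Sat M ρ ψ)
Sat-iff em M ρ φ ψ = mk⇔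
  (λ (φ⇒ψ , ψ⇒φ) → mk⇔ (λ p → decidable-stable (em _) (λ ¬q → φ⇒ψ (p , ¬q)))
                       (λ q → decidable-stable (em _) (λ ¬p → ψ⇒φ (q , ¬p))))
  (λ φ⇔ψ → (λ (p , ¬q) → ¬q (to φ⇔ψ p)) , (λ (q , ¬p) → ¬p (from φ⇔ψ q)))

TwoPoints : Model K → Set
TwoPoints M = Σ (Carrier M) λ a → Σ (Carrier M) λ b → a ≢ b

twoPoints : ExcludedMiddle → (M : Model K) → ¬ HasOneElement M → TwoPoints M
twoPoints em M notOne with em (Σ (Carrier M) λ b → b ≢ point M)
... | yes (b , b≢pt) = b , point M , b≢pt
... | no ∄b = contradiction (point M , λ b → decidable-stable (em _) (λ b≢pt → ∄b (b , b≢pt))) notOne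

≔-same : (ρ : ℕ → A) (i : ℕ) (a : A) → (ρ [ i ≔ a ]) i ≡ a
≔-same ρ i a with i ≡ᵇ i | ≡⇒≡ᵇ i i refl
... | true  | _  = refl
... | false | ()

≔-other : (ρ : ℕ → A) {i j : ℕ} (a : A) → j ≢ i → (ρ [ i ≔ a ]) j ≡ ρ j
≔-other ρ {i} {j} a j≢i with j ≡ᵇ i | ≡ᵇ⇒≡ j i
... | false | _   = refl
... | true  | j≡i = contradiction (j≡i tt) j≢i

fresh : Vec ℕ k → ℕ
fresh []       = 0
fresh (x ∷ vs) = suc x ⊔ fresh vs

map-≔-fresh : (ρ : ℕ → A) (a : A) (vs : Vec ℕ k) → fresh vs ≤ m → map (ρ [ m ≔ a ]) vs ≡ map ρ vs
map-≔-fresh ρ a []       _ = refl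
map-≔-fresh ρ a (x ∷ vs) p = cong₂ _∷_
  (≔-other ρ a (<⇒≢ (m⊔n≤o⇒m≤o (suc x) (fresh vs) p)))
  (map-≔-fresh ρ a vs (m⊔n≤o⇒n≤o (suc x) (fresh vs) p))

map-≔-replicate : (ρ : ℕ → A) (i : ℕ) (a : A) (k : ℕ) → map (ρ [ i ≔ a ]) (replicate k i) ≡ replicate k a
map-≔-replicate ρ i a k = trans (map-replicate (ρ [ i ≔ a ]) i k) (cong (replicate k) (≔-same ρ i a))

take-drop-++ : (as : Vec A m) (bs : Vec A n) → take m (as ++ bs) ≡ as × drop m (as ++ bs) ≡ bs
take-drop-++ {m = m} as bs = ++-injective (take m (as ++ bs)) as (take++drop≡id m (as ++ bs))

Leadsto-compose : {L : Lang} {T₁ : Theory L} {T₂ : Theory (extend L n)} {T₃ : Theory (extend (extend L n) m)} →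
  Leadsto n T₁ T₂ → Leadsto m T₂ T₃ → (φ : Formula L) → Entails T₁ φ ⇔ Entails T₃ (embed (embed φ))
Leadsto-compose l₁₂ l₂₃ φ = mk⇔
  (λ T₁⊨φ → proj₂ (l₂₃ (embed φ)) (proj₂ (l₁₂ φ) T₁⊨φ))
  (λ T₃⊨φ → proj₁ (l₁₂ φ) (proj₁ (l₂₃ (embed φ)) T₃⊨φ))

module Merging (em : ExcludedMiddle) (L₁ : Lang) (n₂ n₃ : ℕ) where

  L₃ : Lang
  L₃ = extend (extend L₁ n₂) n₃

  L : Lang
  L = extend L₁ (2 + (n₂ + n₃))

  P Q : Sym L₃
  P = inj₁ (inj₂ tt)
  Q = inj₂ tt

  R : Sym L
  R = inj₂ tt

  defR : AtomMap L L₃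
  defR (inj₁ S)     vs           = rel (inj₁ (inj₁ S)) vs
  defR (inj₂ tt)    (x ∷ y ∷ zs) =
    or (and (eq x y) (rel P (take n₂ zs))) (and (neg (eq x y)) (rel Q (drop n₂ zs)))

  defPQ : AtomMap L₃ L
  defPQ (inj₁ (inj₁ S))  vs = rel (inj₁ S) vs
  defPQ (inj₁ (inj₂ tt)) as = ex c (rel R (c ∷ c ∷ as ++ replicate n₃ c))
    where c = fresh as
  defPQ (inj₂ tt)        bs =
    ex a (ex (suc a) (and (neg (eq a (suc a))) (rel R (a ∷ suc a ∷ replicate n₂ a ++ bs))))
    where a = fresh bs

  viaPQ : Formula L → Formula L₃
  viaPQ = replaceAtoms defR

  viaR : Formula L₃ → Formula L
  viaR = replaceAtoms defPQ

  module _ (M₃ : Model L₃) where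

    Pair : Carrier M₃ → Carrier M₃ → Vec (Carrier M₃) n₂ → Vec (Carrier M₃) n₃ → Set
    Pair a b as bs = ¬ (¬ (a ≡ b × relOf M₃ P as) × ¬ (a ≢ b × relOf M₃ Q bs))

    relR : (S : Sym L) → Vec (Carrier M₃) (arity L S) → Set
    relR (inj₁ S)  xs           = relOf M₃ (inj₁ (inj₁ S)) xs
    relR (inj₂ tt) (a ∷ b ∷ cs) = Pair a b (take n₂ cs) (drop n₂ cs)

    modelR : Model L
    modelR = withRelations M₃ relR

    Pair-++ : (a b : Carrier M₃) (as : Vec (Carrier M₃) n₂) (bs : Vec (Carrier M₃) n₃) →
      relR R (a ∷ b ∷ as ++ bs) ⇔ Pair a b as bs
    Pair-++ a b as bs rewrite proj₁ (take-drop-++ as bs) | proj₂ (take-drop-++ as bs) = ⇔-id _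

    Pair-diagonal : (c : Carrier M₃) {as : Vec (Carrier M₃) n₂} {bs : Vec (Carrier M₃) n₃} →
      Pair c c as bs ⇔ relOf M₃ P as
    Pair-diagonal c = mk⇔
      (λ pair → decidable-stable (em _) (λ ¬p → pair ((λ (_ , p) → ¬p p) , (λ (c≢c , _) → c≢c refl))))
      (λ p (¬p , _) → ¬p (refl , p))

    Pair-offDiagonal : {a b : Carrier M₃} → a ≢ b → {as : Vec (Carrier M₃) n₂} {bs : Vec (Carrier M₃) n₃} →
      Pair a b as bs ⇔ relOf M₃ Q bs
    Pair-offDiagonal a≢b = mk⇔
      (λ pair → decidable-stable (em _) (λ ¬q → pair ((λ (a≡b , _) → a≢b a≡b) , (λ (_ , q) → ¬q q))))
      (λ q (_ , ¬q) → ¬q (a≢b , q))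

    defR-sound : ∀ ρ S vs → relR S (map ρ vs) ⇔ Sat M₃ ρ (defR S vs)
    defR-sound ρ (inj₁ S)  vs           = ⇔-id _
    defR-sound ρ (inj₂ tt) (x ∷ y ∷ zs) rewrite take-map ρ n₂ zs | drop-map ρ n₂ zs = ⇔-id _

    Sat-viaPQ : ∀ ρ φ → Sat modelR ρ φ ⇔ Sat M₃ ρ (viaPQ φ)
    Sat-viaPQ = Sat-replaceAtoms M₃ relR defR defR-sound

  module _ (M : Model L) where

    relPQ : (S : Sym L₃) → Vec (Carrier M) (arity L₃ S) → Set
    relPQ (inj₁ (inj₁ S))  xs = relOf M (inj₁ S) xs
    relPQ (inj₁ (inj₂ tt)) as = Σ (Carrier M) λ c → relOf M R (c ∷ c ∷ as ++ replicate n₃ c)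
    relPQ (inj₂ tt)        bs =
      Σ (Carrier M) λ a → Σ (Carrier M) λ b → a ≢ b × relOf M R (a ∷ b ∷ replicate n₂ a ++ bs)

    modelPQ : Model L₃
    modelPQ = withRelations M relPQ

    defPQ-sound : ∀ ρ S vs → relPQ S (map ρ vs) ⇔ Sat M ρ (defPQ S vs)
    defPQ-sound ρ (inj₁ (inj₁ S))  vs = ⇔-id _
    defPQ-sound ρ (inj₁ (inj₂ tt)) as = Σ-⇔ (↠-id _) (λ {c} → ≡⇒⇔ (cong (relOf M R) (sym (args c))))
      where
      ρ[_] : Carrier M → ℕ → Carrier M
      ρ[ c ] = ρ [ fresh as ≔ c ]

      args : ∀ c → map ρ[ c ] (fresh as ∷ fresh as ∷ as ++ replicate n₃ (fresh as))
                 ≡ c ∷ c ∷ map ρ as ++ replicate n₃ c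
      args c = cong₂ (λ x ys → x ∷ x ∷ ys) (≔-same ρ (fresh as) c)
        (trans (map-++ ρ[ c ] as (replicate n₃ (fresh as)))
               (cong₂ _++_ (map-≔-fresh ρ c as ≤-refl) (map-≔-replicate ρ (fresh as) c n₃)))
    defPQ-sound ρ (inj₂ tt) bs = Σ-⇔ (↠-id _) λ {a} → Σ-⇔ (↠-id _) λ {b} →
      ¬-cong-⇔ (≡⇒⇔ (sym (cong₂ _≡_ (first a b) (second a b))))
        ×-⇔ ≡⇒⇔ (cong (relOf M R) (sym (args a b)))
      where
      ρ[_,_] : Carrier M → Carrier M → ℕ → Carrier M
      ρ[ a , b ] = (ρ [ fresh bs ≔ a ]) [ suc (fresh bs) ≔ b ]

      first : ∀ a b → ρ[ a , b ] (fresh bs) ≡ a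
      first a b = trans (≔-other (ρ [ fresh bs ≔ a ]) b (<⇒≢ ≤-refl)) (≔-same ρ (fresh bs) a)

      second : ∀ a b → ρ[ a , b ] (suc (fresh bs)) ≡ b
      second a b = ≔-same (ρ [ fresh bs ≔ a ]) (suc (fresh bs)) b

      args : ∀ a b → map ρ[ a , b ] (fresh bs ∷ suc (fresh bs) ∷ replicate n₂ (fresh bs) ++ bs)
                   ≡ a ∷ b ∷ replicate n₂ a ++ map ρ bs
      args a b = cong₂ _∷_ (first a b) (cong₂ _∷_ (second a b)
        (trans (map-++ ρ[ a , b ] (replicate n₂ (fresh bs)) bs)
               (cong₂ _++_ (trans (map-replicate ρ[ a , b ] (fresh bs) n₂) (cong (replicate n₂) (first a b)))
                           (trans (map-≔-fresh (ρ [ fresh bs ≔ a ]) b bs (n≤1+n (fresh bs)))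
                                  (map-≔-fresh ρ a bs ≤-refl)))))

    Sat-viaR : ∀ ρ χ → Sat modelPQ ρ χ ⇔ Sat M ρ (viaR χ)
    Sat-viaR = Sat-replaceAtoms M relPQ defPQ defPQ-sound

  relPQ-modelR : (M₃ : Model L₃) → TwoPoints M₃ → ∀ S xs → relPQ (modelR M₃) S xs ⇔ relOf M₃ S xs
  relPQ-modelR M₃ _ (inj₁ (inj₁ S)) xs = ⇔-id _
  relPQ-modelR M₃ _ (inj₁ (inj₂ tt)) as = mk⇔
    (λ (c , r) → to (Pair-diagonal M₃ c ⇔-∘ Pair-++ M₃ c c as _) r)
    (λ p → point M₃ , from (Pair-diagonal M₃ (point M₃) ⇔-∘ Pair-++ M₃ _ _ as _) p)
  relPQ-modelR M₃ (a₀ , b₀ , a₀≢b₀) (inj₂ tt) bs = mk⇔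
    (λ (a , b , a≢b , r) → to (Pair-offDiagonal M₃ a≢b ⇔-∘ Pair-++ M₃ a b _ bs) r)
    (λ q → a₀ , b₀ , a₀≢b₀ , from (Pair-offDiagonal M₃ a₀≢b₀ ⇔-∘ Pair-++ M₃ a₀ b₀ _ bs) q)

  viaPQ-viaR : (M₃ : Model L₃) → TwoPoints M₃ → ∀ ρ χ → Sat M₃ ρ (viaPQ (viaR χ)) ⇔ Sat M₃ ρ χ
  viaPQ-viaR M₃ two ρ χ = begin
    Sat M₃ ρ (viaPQ (viaR χ))                                   ≡⟨ cong (Sat M₃ ρ) (replaceAtoms-∘ defR defPQ χ) ⟩
    Sat M₃ ρ (replaceAtoms (λ S vs → viaPQ (defPQ S vs)) χ)     ∼⟨ ⇔-sym (Sat-replaceAtoms M₃ (relOf M₃) _ atom ρ χ) ⟩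
    Sat M₃ ρ χ                                                  ∎
    where
    open EquationalReasoning
    atom : ∀ ρ S vs → relOf M₃ S (map ρ vs) ⇔ Sat M₃ ρ (viaPQ (defPQ S vs))
    atom ρ S vs = begin
      relOf M₃ S (map ρ vs)             ∼⟨ ⇔-sym (relPQ-modelR M₃ two S (map ρ vs)) ⟩
      relPQ (modelR M₃) S (map ρ vs)    ∼⟨ defPQ-sound (modelR M₃) ρ S vs ⟩
      Sat (modelR M₃) ρ (defPQ S vs)    ∼⟨ Sat-viaPQ M₃ ρ (defPQ S vs) ⟩
      Sat M₃ ρ (viaPQ (defPQ S vs))     ∎

  defAxiom : Vec ℕ (arity L R) → Formula L
  defAxiom vs = iff (rel R vs) (viaR (viaPQ (rel R vs)))

  modelR-definesR : (M₃ : Model L₃) → TwoPoints M₃ → ∀ vs → modelR M₃ ⊨ defAxiom vs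
  modelR-definesR M₃ two vs ρ = from (Sat-viaPQ M₃ ρ (defAxiom vs))
    (from (Sat-iff em M₃ ρ (viaPQ (rel R vs)) (viaPQ (viaR (viaPQ (rel R vs)))))
          (⇔-sym (viaPQ-viaR M₃ two ρ (viaPQ (rel R vs)))))

  viaR-viaPQ : (M : Model L) → (∀ vs → M ⊨ defAxiom vs) → ∀ ρ φ → Sat M ρ (viaR (viaPQ φ)) ⇔ Sat M ρ φ
  viaR-viaPQ M defines ρ φ = begin
    Sat M ρ (viaR (viaPQ φ))                                    ≡⟨ cong (Sat M ρ) (replaceAtoms-∘ defPQ defR φ) ⟩
    Sat M ρ (replaceAtoms (λ S vs → viaR (defR S vs)) φ)        ∼⟨ ⇔-sym (Sat-replaceAtoms M (relOf M) _ atom ρ φ) ⟩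
    Sat M ρ φ                                                   ∎
    where
    open EquationalReasoning
    atom : ∀ ρ S vs → relOf M S (map ρ vs) ⇔ Sat M ρ (viaR (defR S vs))
    atom ρ (inj₁ S)  vs = ⇔-id _
    atom ρ (inj₂ tt) vs = to (Sat-iff em M ρ (rel R vs) (viaR (defR R vs))) (defines vs ρ)

  viaPQ-embed : (φ : Formula L₁) → viaPQ (embed φ) ≡ embed (embed φ)
  viaPQ-embed (eq i j)   = refl
  viaPQ-embed (rel S vs) = refl
  viaPQ-embed (and φ ψ)  = cong₂ and (viaPQ-embed φ) (viaPQ-embed ψ)
  viaPQ-embed (neg φ)    = cong neg (viaPQ-embed φ)
  viaPQ-embed (ex i φ)   = cong (ex i) (viaPQ-embed φ)

  viaR-embed : (φ : Formula L₁) → viaR (embed (embed φ)) ≡ embed φ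
  viaR-embed (eq i j)   = refl
  viaR-embed (rel S vs) = refl
  viaR-embed (and φ ψ)  = cong₂ and (viaR-embed φ) (viaR-embed ψ)
  viaR-embed (neg φ)    = cong neg (viaR-embed φ)
  viaR-embed (ex i φ)   = cong (ex i) (viaR-embed φ)

  data Merged (T₃ : Theory L₃) : Theory L where
    translated : ∀ {χ} → T₃ χ → Merged T₃ (viaR χ)
    definesR   : ∀ vs → Merged T₃ (defAxiom vs)

  module _ (T₃ : Theory L₃) (noSize1 : NoModelOfSize1 T₃) where

    models-twoPoints : (M₃ : Model L₃) → IsModel M₃ T₃ → TwoPoints M₃
    models-twoPoints M₃ M₃⊨T₃ = twoPoints em M₃ (noSize1 M₃ M₃⊨T₃)

    modelR-isModel : (M₃ : Model L₃) → IsModel M₃ T₃ → IsModel (modelR M₃) (Merged T₃)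
    modelR-isModel M₃ M₃⊨T₃ _ (translated {χ} T₃χ) ρ =
      from (viaPQ-viaR M₃ (models-twoPoints M₃ M₃⊨T₃) ρ χ ⇔-∘ Sat-viaPQ M₃ ρ (viaR χ))
           (M₃⊨T₃ χ T₃χ ρ)
    modelR-isModel M₃ M₃⊨T₃ _ (definesR vs) = modelR-definesR M₃ (models-twoPoints M₃ M₃⊨T₃) vs

    modelPQ-isModel : (M : Model L) → IsModel M (Merged T₃) → IsModel (modelPQ M) T₃
    modelPQ-isModel M M⊨T χ T₃χ ρ = from (Sat-viaR M ρ χ) (M⊨T (viaR χ) (translated T₃χ) ρ)

    viaPQ-interprets : IsInterpretation (atomTranslation defR) (Merged T₃) T₃
    viaPQ-interprets φ T⊨φ M₃ M₃⊨T₃ ρ = to (Sat-viaPQ M₃ ρ φ) (T⊨φ (modelR M₃) (modelR-isModel M₃ M₃⊨T₃) ρ)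

    viaR-interprets : IsInterpretation (atomTranslation defPQ) T₃ (Merged T₃)
    viaR-interprets χ T₃⊨χ M M⊨T ρ = to (Sat-viaR M ρ χ) (T₃⊨χ (modelPQ M) (modelPQ-isModel M M⊨T) ρ)

    Merged-defEquiv : DefEquiv (Merged T₃) T₃
    Merged-defEquiv =
      atomTranslation defR , atomTranslation defPQ , viaPQ-interprets , viaR-interprets ,
      (λ φ M M⊨T ρ → from (Sat-iff em M ρ (viaR (viaPQ φ)) φ)
        (viaR-viaPQ M (λ vs → M⊨T _ (definesR vs)) ρ φ)) ,
      (λ χ M₃ M₃⊨T₃ ρ → from (Sat-iff em M₃ ρ (viaPQ (viaR χ)) χ)
        (viaPQ-viaR M₃ (models-twoPoints M₃ M₃⊨T₃) ρ χ))

    Merged-embed : (φ : Formula L₁) → Entails T₃ (embed (embed φ)) ⇔ Entails (Merged T₃) (embed φ)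
    Merged-embed φ = mk⇔
      (λ T₃⊨φ → subst (Entails (Merged T₃)) (viaR-embed φ) (viaR-interprets (embed (embed φ)) T₃⊨φ))
      (λ T⊨φ → subst (Entails T₃) (viaPQ-embed φ) (viaPQ-interprets (embed φ) T⊨φ))

    Merged-leadsto : {T₁ : Theory L₁} {T₂ : Theory (extend L₁ n₂)} →
      Leadsto n₂ T₁ T₂ → Leadsto n₃ T₂ T₃ → Leadsto (2 + (n₂ + n₃)) T₁ (Merged T₃)
    Merged-leadsto l₁₂ l₂₃ φ = from T₁⇔T , to T₁⇔T
      where T₁⇔T = Merged-embed φ ⇔-∘ Leadsto-compose l₁₂ l₂₃ φ

lemma4p8 : ExcludedMiddle →
    (L₁ : Lang) (n₂ n₃ : ℕ)
    (T₁ : Theory L₁) (T₂ : Theory (extend L₁ n₂)) (T₃ : Theory (extend (extend L₁ n₂) n₃)) →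
    NoModelOfSize1 T₁ → NoModelOfSize1 T₂ → NoModelOfSize1 T₃ →
    Leadsto n₂ T₁ T₂ → Leadsto n₃ T₂ T₃ →
    Σ ℕ λ n → Σ (Theory (extend L₁ n)) λ T → Leadsto n T₁ T × DefEquiv T T₃
lemma4p8 em L₁ n₂ n₃ _ _ T₃ _ _ noSize1 l₁₂ l₂₃ =
  2 + (n₂ + n₃) , Merged T₃ , Merged-leadsto T₃ noSize1 l₁₂ l₂₃ , Merged-defEquiv T₃ noSize1
  where open Merging em L₁ n₂ n₃
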